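{- Let $(S,\mathfrak{m})$ be a finite local Frobenius ring with residue field $\mathbb{F}_2$. Then there exists a unique $e\in S$ such that $\mathrm{Ann}_S(e)=\mathfrak{m}$. Furthermore, if $\psi\colon S\to\mathbb{Z}/n$ is any nondegenerate $\mathbb{Z}/n$-linear functional (with $nS=0$), then $\frac{\psi(e)}{n}\equiv\frac12\pmod 1$.
   Context: All rings are finite, commutative with identity. A finite ring $S$ is Frobenius if for some positive integer $n$ with $nS=0$ there is a $\mathbb{Z}/n$-linear map $\psi\colon S\to\mathbb{Z}/n$ that is nondegenerate, i.e. its kernel contains no nonzero ideal. For $y\in\mathbb{Z}/n$, $y/n$ denotes the class in $\mathbb{R}/\mathbb{Z}$ of $k/n$ for an integer representative $k$ of $y$. -}

module Defs where

open import Level using (_⊔_)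
open import Algebra.Bundles using (CommutativeRing)
open import Data.Nat as ℕ using (ℕ; zero; suc; NonZero; _%_)
open import Data.Fin using (Fin; toℕ)
open import Data.Integer as ℤ using (ℤ; +_)
open import Data.Product using (Σ; ∃; ∃-syntax; _×_; _,_)
open import Data.Sum using (_⊎_)
open import Relation.Nullary using (¬_)
open import Relation.Binary.PropositionalEquality using (_≡_)
open import Relation.Unary using (Pred; _∈_)

-- y / n ≡ 1/2 (mod 1), for y ∈ ℤ/n represented by its least non-negative
-- representative toℕ y:  toℕ y / n - 1/2 is an integer m, i.e. (clearing
-- denominators) 2·y - n = 2n·m in ℤ.
HalfMod1 : (n : ℕ) → Fin n → Set
HalfMod1 n y = ∃[ m ] ((+ (2 ℕ.* toℕ y)) ℤ.- (+ n) ≡ (+ (2 ℕ.* n)) ℤ.* m)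

module _ {c ℓ} (S : CommutativeRing c ℓ) where
  open CommutativeRing S

  IsFinite : Set (c ⊔ ℓ)
  IsFinite = ∃[ k ] Σ (Fin k → Carrier) λ f → Σ (Carrier → Fin k) λ g →
    (∀ x → f (g x) ≈ x) × (∀ i → g (f i) ≡ i) × (∀ {x y} → x ≈ y → g x ≡ g y)

  IsUnit : Carrier → Set (c ⊔ ℓ)
  IsUnit x = ∃[ y ] (x * y ≈ 1#)

  𝔪 : Pred Carrier (c ⊔ ℓ)
  𝔪 x = ¬ IsUnit x

  -- local ring: nontrivial, and the non-units form an ideal
  -- (closure of non-units under multiplication by S is automatic)
  IsLocal : Set (c ⊔ ℓ)
  IsLocal = ¬ (1# ≈ 0#) × (∀ x y → x ∈ 𝔪 → y ∈ 𝔪 → (x + y) ∈ 𝔪)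

  ResidueFieldF₂ : Set (c ⊔ ℓ)
  ResidueFieldF₂ = ∀ x → x ∈ 𝔪 ⊎ (x + (- 1#)) ∈ 𝔪

  AnnIs𝔪 : Carrier → Set (c ⊔ ℓ)
  AnnIs𝔪 e = ∀ x → ((x * e ≈ 0#) → x ∈ 𝔪) × (x ∈ 𝔪 → x * e ≈ 0#)

  _·_ : ℕ → Carrier → Carrier
  zero  · x = 0#
  suc n · x = x + (n · x)

  IsIdeal : Pred Carrier (c ⊔ ℓ) → Set (c ⊔ ℓ)
  IsIdeal I = (0# ∈ I) × (∀ x y → x ∈ I → y ∈ I → (x + y) ∈ I)
              × (∀ s x → x ∈ I → (s * x) ∈ I)

  IsLinear : (n : ℕ) .{{_ : NonZero n}} → (Carrier → Fin n) → Set (c ⊔ ℓ)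
  IsLinear n ψ = (∀ {x y} → x ≈ y → ψ x ≡ ψ y)
    × (∀ x y → toℕ (ψ (x + y)) ≡ (toℕ (ψ x) ℕ.+ toℕ (ψ y)) % n)
    × (∀ (k : ℕ) x → toℕ (ψ (k · x)) ≡ (k ℕ.* toℕ (ψ x)) % n)

  IsNondegenerate : (n : ℕ) → (Carrier → Fin n) → Set (Level.suc (c ⊔ ℓ))
  IsNondegenerate n ψ = ∀ (I : Pred Carrier (c ⊔ ℓ)) → IsIdeal I →
    (∀ x → x ∈ I → toℕ (ψ x) ≡ 0) → ∀ x → x ∈ I → x ≈ 0#

  IsFrobenius : Set (Level.suc (c ⊔ ℓ))
  IsFrobenius = ∃[ n ] Σ (NonZero n) λ nz → (∀ x → n · x ≈ 0#) ×
    Σ (Carrier → Fin n) λ ψ → IsLinear n {{nz}} ψ × IsNondegenerate n ψ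

{-# OPTIONS --safe #-}
-- A finite local ring has a nonzero socle element e, and any such e has Ann(e) = 𝔪.
-- With residue field F₂ the ideal S·e is {0, e} and 2 ∈ 𝔪 kills e, so nondegeneracy of ψ
-- forces ψ(e) ≠ 0 while 2ψ(e) = 0 in ℤ/n, i.e. ψ(e) = n/2. For two nonzero socle elements
-- a, b this gives ψ(a + b) = 0 with a + b in the socle, hence a + b = 0 and a = -b = b.
module Submission where

open import Defs
open import Level using (Level; _⊔_)
open import Algebra.Bundles using (CommutativeRing)
open import Data.Nat using (ℕ; NonZero)
open import Data.Fin using (Fin)
open import Data.Product using (Σ; _×_)

open import Data.Nat as ℕ using (zero; suc; _<_; _<′_; ≤′-refl; ≤′-step; _%_)
import Data.Nat.Properties as ℕₚ
open import Data.Nat.DivMod using (m*n%n≡0; n%n≡0)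
open import Data.Nat.Divisibility using (divides; m%n≡0⇒n∣m)
open import Data.Integer as ℤ using (+_)
import Data.Integer.Properties as ℤₚ
open import Data.Fin using (toℕ)
open import Data.Fin.Properties using (_≟_; any?; pigeonhole; toℕ<n)
open import Data.Product using (∃-syntax; _,_; proj₁; proj₂)
open import Data.Sum using (_⊎_; inj₁; inj₂)
open import Data.Empty using (⊥; ⊥-elim)
open import Relation.Nullary using (¬_; Dec; yes; no; contradiction)
open import Relation.Nullary.Decidable using (¬?; _×-dec_)
open import Relation.Binary.PropositionalEquality as ≡ using (_≡_; _≢_)
open import Relation.Unary using (Pred; _∈_; Decidable)
import Algebra.Properties.Ring as RingProperties
import Algebra.Properties.Group as GroupProperties

2*y%n≡0⇒2*y≡n : ∀ {y n} .{{_ : NonZero n}} → y < n → y ≢ 0 → (2 ℕ.* y) % n ≡ 0 → 2 ℕ.* y ≡ n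
2*y%n≡0⇒2*y≡n {y} {n} y<n y≢0 2y%n≡0 with m%n≡0⇒n∣m (2 ℕ.* y) n 2y%n≡0
... | divides zero 2y≡0 = contradiction (ℕₚ.*-cancelˡ-≡ y 0 2 2y≡0) y≢0
... | divides 1 2y≡n = ≡.trans 2y≡n (ℕₚ.+-identityʳ n)
... | divides (suc (suc q)) 2y≡[2+q]n =
  contradiction 2n≤2y (ℕₚ.<⇒≱ (ℕₚ.*-monoʳ-< 2 y<n))
  where
  2n≤2y : 2 ℕ.* n ℕ.≤ 2 ℕ.* y
  2n≤2y = ≡.subst (2 ℕ.* n ℕ.≤_) (≡.sym 2y≡[2+q]n) (ℕₚ.*-monoˡ-≤ n {2} {suc (suc q)} (ℕ.s≤s (ℕ.s≤s ℕ.z≤n)))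

2*y≡n⇒HalfMod1 : ∀ {n} (y : Fin n) → 2 ℕ.* toℕ y ≡ n → HalfMod1 n y
2*y≡n⇒HalfMod1 {n} y 2y≡n = + 0 , (begin
  + (2 ℕ.* toℕ y) ℤ.- + n  ≡⟨ ≡.cong (λ m → + m ℤ.- + n) 2y≡n ⟩
  + n ℤ.- + n              ≡⟨ ℤₚ.+-inverseʳ (+ n) ⟩
  + 0                      ≡⟨ ≡.sym (ℤₚ.*-zeroʳ (+ (2 ℕ.* n))) ⟩
  + (2 ℕ.* n) ℤ.* + 0      ∎)
  where open ≡.≡-Reasoning

module _ {c ℓ : Level} (S : CommutativeRing c ℓ) where
  open CommutativeRing S
  open import Relation.Binary.Reasoning.Setoid setoid
  open RingProperties ring using (-‿distribʳ-*)
  open GroupProperties +-group using (inverseˡ-unique)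

  Socle : Pred Carrier (c ⊔ ℓ)
  Socle y = ∀ x → x ∈ 𝔪 S → x * y ≈ 0#

  𝔪-resp-≈ : ∀ {x y} → x ≈ y → x ∈ 𝔪 S → y ∈ 𝔪 S
  𝔪-resp-≈ x≈y x∈𝔪 (u , yu≈1) = x∈𝔪 (u , trans (*-cong x≈y refl) yu≈1)

  𝔪-*-closed : ∀ s {z} → z ∈ 𝔪 S → s * z ∈ 𝔪 S
  𝔪-*-closed s {z} z∈𝔪 (u , szu≈1) =
    z∈𝔪 (s * u , trans (sym (*-assoc z s u)) (trans (*-cong (*-comm z s) refl) szu≈1))

  1∉𝔪 : ¬ 1# ∈ 𝔪 S
  1∉𝔪 1∈𝔪 = 1∈𝔪 (1# , *-identityˡ 1#)

  AnnIs𝔪⇒Socle : ∀ {e} → AnnIs𝔪 S e → e ∈ Socle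
  AnnIs𝔪⇒Socle ann x x∈𝔪 = proj₂ (ann x) x∈𝔪

  AnnIs𝔪⇒≉0 : ∀ {e} → AnnIs𝔪 S e → e ≉ 0#
  AnnIs𝔪⇒≉0 {e} ann e≈0 = 1∉𝔪 (proj₁ (ann 1#) (trans (*-identityˡ e) e≈0))

  nonzero-Socle⇒AnnIs𝔪 : ∀ {e} → e ≉ 0# → e ∈ Socle → AnnIs𝔪 S e
  nonzero-Socle⇒AnnIs𝔪 {e} e≉0 e∈Soc x = xe≈0⇒x∈𝔪 , e∈Soc x
    where
    xe≈0⇒x∈𝔪 : x * e ≈ 0# → x ∈ 𝔪 S
    xe≈0⇒x∈𝔪 xe≈0 (u , xu≈1) = e≉0 (begin
      e             ≈⟨ sym (*-identityˡ e) ⟩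
      1# * e        ≈⟨ *-cong (sym xu≈1) refl ⟩
      (x * u) * e   ≈⟨ *-cong (*-comm x u) refl ⟩
      (u * x) * e   ≈⟨ *-assoc u x e ⟩
      u * (x * e)   ≈⟨ *-cong refl xe≈0 ⟩
      u * 0#        ≈⟨ zeroʳ u ⟩
      0#            ∎)

  fixed-by-unit-complement⇒≈0 : ∀ {y z} → IsUnit S (1# - z) → y ≈ z * y → y ≈ 0#
  fixed-by-unit-complement⇒≈0 {y} {z} (u , [1-z]u≈1) y≈zy = begin
    y                   ≈⟨ sym (*-identityʳ y) ⟩
    y * 1#              ≈⟨ *-cong refl (sym [1-z]u≈1) ⟩
    y * ((1# - z) * u)  ≈⟨ sym (*-assoc y _ u) ⟩
    (y * (1# - z)) * u  ≈⟨ *-cong y[1-z]≈0 refl ⟩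
    0# * u              ≈⟨ zeroˡ u ⟩
    0#                  ∎
    where
    y[1-z]≈0 : y * (1# - z) ≈ 0#
    y[1-z]≈0 = begin
      y * (1# - z)         ≈⟨ distribˡ y 1# (- z) ⟩
      y * 1# + y * - z     ≈⟨ +-cong (*-identityʳ y) (sym (-‿distribʳ-* y z)) ⟩
      y - y * z            ≈⟨ +-cong refl (-‿cong (trans (*-comm y z) (sym y≈zy))) ⟩
      y - y                ≈⟨ -‿inverseʳ y ⟩
      0#                   ∎

  module _ {k : ℕ} (f : Fin k → Carrier) (g : Carrier → Fin k)
           (f∘g≈id : ∀ x → f (g x) ≈ x) (g-cong : ∀ {x y} → x ≈ y → g x ≡ g y) where

    g-injective : ∀ {x y} → g x ≡ g y → x ≈ y
    g-injective {x} {y} gx≡gy = trans (sym (f∘g≈id x)) (trans (reflexive (≡.cong f gx≡gy)) (f∘g≈id y))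

    _≈?_ : ∀ x y → Dec (x ≈ y)
    x ≈? y with g x ≟ g y
    ... | yes gx≡gy = yes (g-injective gx≡gy)
    ... | no gx≢gy  = no (λ x≈y → gx≢gy (g-cong x≈y))

    isUnit? : Decidable (IsUnit S)
    isUnit? x with any? (λ i → (x * f i) ≈? 1#)
    ... | yes (i , x*fi≈1) = yes (f i , x*fi≈1)
    ... | no ∄i            = no (λ (u , xu≈1) → ∄i (g u , trans (*-cong refl (f∘g≈id u)) xu≈1))

    Socle-or-nonannihilator : ∀ y → y ∈ Socle ⊎ ∃[ x ] (x ∈ 𝔪 S × x * y ≉ 0#)
    Socle-or-nonannihilator y with any? (λ i → ¬? (isUnit? (f i)) ×-dec ¬? ((f i * y) ≈? 0#))
    ... | yes (i , fi∈𝔪 , fi*y≉0) = inj₂ (f i , fi∈𝔪 , fi*y≉0)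
    ... | no ∄i = inj₁ y∈Socle
      where
      y∈Socle : y ∈ Socle
      y∈Socle x x∈𝔪 with (x * y) ≈? 0#
      ... | yes xy≈0 = xy≈0
      ... | no xy≉0  = ⊥-elim (∄i (g x , 𝔪-resp-≈ (sym (f∘g≈id x)) x∈𝔪
                                       , λ fgx*y≈0 → xy≉0 (trans (*-cong (sym (f∘g≈id x)) refl) fgx*y≈0)))

    Socle? : Decidable Socle
    Socle? y with Socle-or-nonannihilator y
    ... | inj₁ y∈Socle              = yes y∈Socle
    ... | inj₂ (x , x∈𝔪 , xy≉0)     = no (λ y∈Socle → xy≉0 (y∈Socle x x∈𝔪))

    module _ (loc : IsLocal S) where

      1-𝔪-isUnit : ∀ {z} → z ∈ 𝔪 S → IsUnit S (1# - z)
      1-𝔪-isUnit {z} z∈𝔪 with isUnit? (1# - z)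
      ... | yes 1-z-unit = 1-z-unit
      ... | no 1-z∈𝔪     = contradiction (𝔪-resp-≈ 1-z+z≈1 (proj₂ loc _ _ 1-z∈𝔪 z∈𝔪)) 1∉𝔪
        where
        1-z+z≈1 : (1# - z) + z ≈ 1#
        1-z+z≈1 = trans (+-assoc 1# (- z) z) (trans (+-cong refl (-‿inverseˡ z)) (+-identityʳ 1#))

      -- Starting from 1 and multiplying by non-annihilating elements of 𝔪 gives nonzero y₀, y₁, …;
      -- by pigeonhole some yⱼ equals an earlier yᵢ, so yᵢ ≈ z * yᵢ with z ∈ 𝔪, forcing yᵢ ≈ 0.
      module NonannihilatorChain (step : ∀ y → y ≉ 0# → ∃[ x ] (x ∈ 𝔪 S × x * y ≉ 0#)) where

        y : ℕ → Carrier
        y≉0 : ∀ t → y t ≉ 0#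

        y zero    = 1#
        y (suc t) = proj₁ (step (y t) (y≉0 t)) * y t

        y≉0 zero    = proj₁ loc
        y≉0 (suc t) = proj₂ (proj₂ (step (y t) (y≉0 t)))

        y-descends : ∀ {i j} → i <′ j → ∃[ z ] (z ∈ 𝔪 S × y j ≈ z * y i)
        y-descends {i} ≤′-refl = proj₁ (step (y i) (y≉0 i)) , proj₁ (proj₂ (step (y i) (y≉0 i))) , refl
        y-descends (≤′-step {j} i<j) with y-descends i<j
        ... | z , z∈𝔪 , yj≈zyi = x * z , 𝔪-*-closed x z∈𝔪 , trans (*-cong refl yj≈zyi) (sym (*-assoc x z _))
          where
          x : Carrier
          x = proj₁ (step (y j) (y≉0 j))

        impossible : ⊥
        impossible with pigeonhole (ℕₚ.n<1+n k) (λ i → g (y (toℕ i)))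
        ... | i , j , i<j , gyi≡gyj with y-descends (ℕₚ.<⇒<′ i<j)
        ... | z , z∈𝔪 , yj≈zyi =
          y≉0 (toℕ i) (fixed-by-unit-complement⇒≈0 (1-𝔪-isUnit z∈𝔪) (trans (g-injective gyi≡gyj) yj≈zyi))

      ∃nonzero-Socle : ∃[ e ] (e ≉ 0# × e ∈ Socle)
      ∃nonzero-Socle with any? (λ i → ¬? (f i ≈? 0#) ×-dec Socle? (f i))
      ... | yes (i , fi≉0 , fi∈Socle) = f i , fi≉0 , fi∈Socle
      ... | no ∄i = ⊥-elim (NonannihilatorChain.impossible step)
        where
        step : ∀ y → y ≉ 0# → ∃[ x ] (x ∈ 𝔪 S × x * y ≉ 0#)
        step y y≉0 with Socle-or-nonannihilator y
        ... | inj₂ nonannihilator = nonannihilator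
        ... | inj₁ y∈Socle = ⊥-elim (∄i (g y , (λ fgy≈0 → y≉0 (trans (sym (f∘g≈id y)) fgy≈0))
                                            , λ x x∈𝔪 → trans (*-cong refl (f∘g≈id y)) (y∈Socle x x∈𝔪)))

  module _ (res : ResidueFieldF₂ S) where

    1+1∈𝔪 : 1# + 1# ∈ 𝔪 S
    1+1∈𝔪 with res (1# + 1#)
    ... | inj₁ 2∈𝔪 = 2∈𝔪
    ... | inj₂ 1∈𝔪 = contradiction (𝔪-resp-≈ 1+1-1≈1 1∈𝔪) 1∉𝔪
      where
      1+1-1≈1 : (1# + 1#) - 1# ≈ 1#
      1+1-1≈1 = trans (+-assoc 1# 1# (- 1#)) (trans (+-cong refl (-‿inverseʳ 1#)) (+-identityʳ 1#))

    Socle⇒e+e≈0 : ∀ {e} → e ∈ Socle → e + e ≈ 0#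
    Socle⇒e+e≈0 {e} e∈Soc = begin
      e + e             ≈⟨ sym (+-cong (*-identityˡ e) (*-identityˡ e)) ⟩
      1# * e + 1# * e   ≈⟨ sym (distribʳ e 1# 1#) ⟩
      (1# + 1#) * e     ≈⟨ e∈Soc _ 1+1∈𝔪 ⟩
      0#                ∎

    Socle⇒*≈0⊎*≈id : ∀ {a} → a ∈ Socle → ∀ s → s * a ≈ 0# ⊎ s * a ≈ a
    Socle⇒*≈0⊎*≈id {a} a∈Soc s with res s
    ... | inj₁ s∈𝔪   = inj₁ (a∈Soc s s∈𝔪)
    ... | inj₂ s-1∈𝔪 = inj₂ (begin
      s * a                     ≈⟨ *-cong (sym s-1+1≈s) refl ⟩
      ((s - 1#) + 1#) * a       ≈⟨ distribʳ a _ _ ⟩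
      (s - 1#) * a + 1# * a     ≈⟨ +-cong (a∈Soc _ s-1∈𝔪) (*-identityˡ a) ⟩
      0# + a                    ≈⟨ +-identityˡ a ⟩
      a                         ∎)
      where
      s-1+1≈s : (s - 1#) + 1# ≈ s
      s-1+1≈s = trans (+-assoc s (- 1#) 1#) (trans (+-cong refl (-‿inverseˡ 1#)) (+-identityʳ s))

    principal-isIdeal : ∀ a → IsIdeal S (λ x → ∃[ s ] (x ≈ s * a))
    principal-isIdeal a =
        (0# , sym (zeroˡ a))
      , (λ x y (s , x≈sa) (t , y≈ta) → s + t , trans (+-cong x≈sa y≈ta) (sym (distribʳ a s t)))
      , (λ r x (s , x≈sa) → r * s , trans (*-cong refl x≈sa) (sym (*-assoc r s a)))

    module _ (n : ℕ) .{{_ : NonZero n}} (ψ : Carrier → Fin n)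
             (lin : IsLinear S n ψ) (nd : IsNondegenerate S n ψ) where

      ψ-cong : ∀ {x y} → x ≈ y → ψ x ≡ ψ y
      ψ-cong = proj₁ lin

      ψ-+ : ∀ x y → toℕ (ψ (x + y)) ≡ (toℕ (ψ x) ℕ.+ toℕ (ψ y)) % n
      ψ-+ = proj₁ (proj₂ lin)

      ψ-· : ∀ k x → toℕ (ψ (_·_ S k x)) ≡ (k ℕ.* toℕ (ψ x)) % n
      ψ-· = proj₂ (proj₂ lin)

      ψ-0# : toℕ (ψ 0#) ≡ 0
      ψ-0# = ≡.trans (ψ-· 0 0#) (m*n%n≡0 0 n)

      ψ≈0⇒≡0 : ∀ {x} → x ≈ 0# → toℕ (ψ x) ≡ 0
      ψ≈0⇒≡0 x≈0 = ≡.trans (≡.cong toℕ (ψ-cong x≈0)) ψ-0#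

      Socle-ψ≡0⇒≈0 : ∀ {a} → a ∈ Socle → toℕ (ψ a) ≡ 0 → a ≈ 0#
      Socle-ψ≡0⇒≈0 {a} a∈Soc ψa≡0 = nd _ (principal-isIdeal a) Sa⊆kerψ a (1# , sym (*-identityˡ a))
        where
        Sa⊆kerψ : ∀ x → ∃[ s ] (x ≈ s * a) → toℕ (ψ x) ≡ 0
        Sa⊆kerψ x (s , x≈sa) with Socle⇒*≈0⊎*≈id a∈Soc s
        ... | inj₁ sa≈0 = ψ≈0⇒≡0 (trans x≈sa sa≈0)
        ... | inj₂ sa≈a = ≡.trans (≡.cong toℕ (ψ-cong (trans x≈sa sa≈a))) ψa≡0

      nonzero-Socle⇒2*ψ≡n : ∀ {e} → e ≉ 0# → e ∈ Socle → 2 ℕ.* toℕ (ψ e) ≡ n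
      nonzero-Socle⇒2*ψ≡n {e} e≉0 e∈Soc =
        2*y%n≡0⇒2*y≡n (toℕ<n (ψ e)) (λ ψe≡0 → e≉0 (Socle-ψ≡0⇒≈0 e∈Soc ψe≡0)) 2ψe%n≡0
        where
        2ψe%n≡0 : (2 ℕ.* toℕ (ψ e)) % n ≡ 0
        2ψe%n≡0 = ≡.trans (≡.sym (ψ-· 2 e)) (ψ≈0⇒≡0 (trans (+-cong refl (+-identityʳ e)) (Socle⇒e+e≈0 e∈Soc)))

      nonzero-Socle-unique : ∀ {a b} → a ≉ 0# → b ≉ 0# → a ∈ Socle → b ∈ Socle → a ≈ b
      nonzero-Socle-unique {a} {b} a≉0 b≉0 a∈Soc b∈Soc =
        trans (inverseˡ-unique a b a+b≈0) (sym (inverseˡ-unique b b (Socle⇒e+e≈0 b∈Soc)))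
        where
        2ψa≡n : 2 ℕ.* toℕ (ψ a) ≡ n
        2ψa≡n = nonzero-Socle⇒2*ψ≡n a≉0 a∈Soc

        2ψb≡n : 2 ℕ.* toℕ (ψ b) ≡ n
        2ψb≡n = nonzero-Socle⇒2*ψ≡n b≉0 b∈Soc

        ψa+ψb≡n : toℕ (ψ a) ℕ.+ toℕ (ψ b) ≡ n
        ψa+ψb≡n = ≡.trans (≡.cong (ℕ._+ toℕ (ψ b)) ψa≡ψb)
                    (≡.trans (≡.cong (toℕ (ψ b) ℕ.+_) (≡.sym (ℕₚ.+-identityʳ _))) 2ψb≡n)
          where
          ψa≡ψb : toℕ (ψ a) ≡ toℕ (ψ b)
          ψa≡ψb = ℕₚ.*-cancelˡ-≡ _ _ 2 (≡.trans 2ψa≡n (≡.sym 2ψb≡n))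

        a+b∈Socle : a + b ∈ Socle
        a+b∈Socle x x∈𝔪 = trans (distribˡ x a b) (trans (+-cong (a∈Soc x x∈𝔪) (b∈Soc x x∈𝔪)) (+-identityʳ 0#))

        a+b≈0 : a + b ≈ 0#
        a+b≈0 = Socle-ψ≡0⇒≈0 a+b∈Socle (≡.trans (ψ-+ a b) (≡.trans (≡.cong (_% n) ψa+ψb≡n) (n%n≡0 n)))

lemma3p4 : ∀ {c ℓ : Level} (S : CommutativeRing c ℓ) →
    let open CommutativeRing S in
    IsFinite S → IsLocal S → ResidueFieldF₂ S → IsFrobenius S →
    (Σ Carrier λ e → AnnIs𝔪 S e × (∀ e′ → AnnIs𝔪 S e′ → e′ ≈ e)) ×
    (∀ e → AnnIs𝔪 S e →
      ∀ (n : ℕ) .{{_ : NonZero n}} → (∀ x → _·_ S n x ≈ 0#) →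
      ∀ (ψ : Carrier → Fin n) → IsLinear S n ψ → IsNondegenerate S n ψ →
      HalfMod1 n (ψ e))
lemma3p4 S (_ , f , g , f∘g≈id , _ , g-cong) loc res (n , nz , _ , ψ , lin , nd)
  with ∃nonzero-Socle S f g f∘g≈id g-cong loc
... | e , e≉0 , e∈Socle =
    (e , nonzero-Socle⇒AnnIs𝔪 S e≉0 e∈Socle
       , λ e′ ann → nonzero-Socle-unique S res n {{nz}} ψ lin nd
                      (AnnIs𝔪⇒≉0 S ann) e≉0 (AnnIs𝔪⇒Socle S ann) e∈Socle)
  , λ e ann m _ ψ′ lin′ nd′ → 2*y≡n⇒HalfMod1 (ψ′ e)
      (nonzero-Socle⇒2*ψ≡n S res m ψ′ lin′ nd′ (AnnIs𝔪⇒≉0 S ann) (AnnIs𝔪⇒Socle S ann))
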